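{- Let $A$ be an $m\times n$ matrix over $\mathbb F_2$ with rows $u_1,\dots,u_m$ and columns $v_1,\dots,v_n$, and let $V=\mathrm{span}(u_1,\dots,u_m)\subseteq\mathbb F_2^n$. Let $K>0$ and suppose that for each $i\in[n]$ with $v_i\neq 0$ there are at least $K$ pairwise disjoint two-element sets $\{j,l\}\subseteq[n]$ with $i\notin\{j,l\}$ and $v_i=v_j+v_l$. Let $\mathbb T$ be the coset leader graph of $V$. Then \[ \dim V\le \log_2\!\left(\sum_{i=0}^{\mathrm{diam}(\mathbb T)}\binom{n}{i}\right)\le \frac{n\log_2(K+1)+n/\ln 2}{K+1}. \]
   Context: For a linear code $V\subseteq\mathbb F_2^n$ with dual $V^\perp$, the coset leader graph $\mathbb T$ of $V$ is the Cayley (multi)graph of $\mathbb F_2^n/V^\perp$ with respect to the generators $e_1+V^\perp,\dots,e_n+V^\perp$; $\mathrm{diam}$ is its diameter in the shortest-path metric. -}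

module Defs where

open import Data.Bool using (Bool; true; false; _xor_; _∧_)
open import Data.Nat using (ℕ; zero; suc; _+_; _*_; _^_; _≤_; _<_)
open import Data.Nat.Combinatorics using (_C_)
open import Data.Fin using (Fin; zero; suc; _≟_)
open import Data.List using (List; []; _∷_; length)
open import Data.Product using (Σ; ∃; ∃₂; _×_; _,_)
open import Relation.Nullary using (¬_; does)
open import Relation.Binary.PropositionalEquality using (_≡_; _≢_)

-- Vectors in F₂ⁿ (F₂ = Bool, addition = xor, multiplication = ∧)
BVec : ℕ → Set
BVec n = Fin n → Bool

sumB : ∀ {k} → (Fin k → Bool) → Bool
sumB {zero} f = false
sumB {suc k} f = f zero xor sumB (λ i → f (suc i))

0ᵥ : ∀ {n} → BVec n
0ᵥ _ = false

_+ᵥ_ : ∀ {n} → BVec n → BVec n → BVec n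
(x +ᵥ y) j = x j xor y j

infix 4 _≈ᵥ_
_≈ᵥ_ : ∀ {n} → BVec n → BVec n → Set
x ≈ᵥ y = ∀ j → x j ≡ y j

dot : ∀ {n} → BVec n → BVec n → Bool
dot x y = sumB (λ j → x j ∧ y j)

e : ∀ {n} → Fin n → BVec n
e i j = does (i ≟ j)

lincomb : ∀ {k n} → (Fin k → BVec n) → (Fin k → Bool) → BVec n
lincomb b c j = sumB (λ i → c i ∧ b i j)

Span : ∀ {k n} → (Fin k → BVec n) → BVec n → Set
Span b x = Σ (_ → Bool) λ c → lincomb b c ≈ᵥ x

Subspace : ℕ → Set₁
Subspace n = BVec n → Set

LinIndep : ∀ {d n} → (Fin d → BVec n) → Set
LinIndep b = ∀ c → lincomb b c ≈ᵥ 0ᵥ → ∀ i → c i ≡ false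

IsBasis : ∀ {d n} → Subspace n → (Fin d → BVec n) → Set
IsBasis V b = (∀ i → V (b i)) × LinIndep b × (∀ x → V x → Span b x)

Dim : ∀ {n} → Subspace n → ℕ → Set
Dim V d = Σ (Fin d → _) λ b → IsBasis V b

-- Matrices m × n over F₂; rows u_r = A r, columns v_i = column A i
Matrix : ℕ → ℕ → Set
Matrix m n = Fin m → Fin n → Bool

column : ∀ {m n} → Matrix m n → Fin n → BVec m
column A i r = A r i

RowSpace : ∀ {m n} → Matrix m n → Subspace n
RowSpace A = Span A

Dual : ∀ {n} → Subspace n → Subspace n
Dual V x = ∀ y → V y → dot y x ≡ false

-- x and y lie in the same coset of V^⊥ (vertices of 𝕋 = F₂ⁿ / V^⊥)
SameCoset : ∀ {n} → Subspace n → BVec n → BVec n → Set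
SameCoset V x y = Dual V (x +ᵥ y)

sumGens : ∀ {n} → List (Fin n) → BVec n
sumGens [] = 0ᵥ
sumGens (i ∷ w) = e i +ᵥ sumGens w

-- In the coset leader graph 𝕋 of V (Cayley graph of F₂ⁿ/V^⊥ w.r.t. e_i + V^⊥),
-- dist(x + V^⊥, y + V^⊥) ≤ k: there is a walk using ≤ k generator steps.
DistLE : ∀ {n} → Subspace n → ℕ → BVec n → BVec n → Set
DistLE V k x y = Σ (List _) λ w → length w ≤ k × SameCoset V (x +ᵥ sumGens w) y

-- D = diam(𝕋)   (vertices represented by coset representatives)
IsDiameter : ∀ {n} → Subspace n → ℕ → Set
IsDiameter V D =
  (∀ x y → DistLE V D x y) ×
  ∃₂ λ x y → ∀ k → k < D → ¬ DistLE V k x y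

PairAvoiding : ∀ {n} → Fin n → Fin n × Fin n → Set
PairAvoiding i (j , l) = j ≢ l × j ≢ i × l ≢ i

Disjoint : ∀ {n} → Fin n × Fin n → Fin n × Fin n → Set
Disjoint (j , l) (j' , l') = j ≢ j' × j ≢ l' × l ≢ j' × l ≢ l'

PairCondition : ∀ {m n} → Matrix m n → ℕ → Set
PairCondition {m} {n} A K =
  ∀ i → ¬ (column A i ≈ᵥ 0ᵥ) →
  Σ (Fin K → Fin n × Fin n) λ p →
    (∀ a → PairAvoiding i (p a)) ×
    (∀ a → let (j , l) = p a in column A i ≈ᵥ (column A j +ᵥ column A l)) ×
    (∀ a b → a ≢ b → Disjoint (p a) (p b))

binSum : ℕ → ℕ → ℕ
binSum n zero = n C 0
binSum n (suc D) = binSum n D + n C (suc D)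

-- p/q > e  (Euler's number).  Since (1+1/N)^{N+1} decreases strictly to e,
-- p/q > e  iff  (1+1/N)^{N+1} ≤ p/q for some N ≥ 1.  Here N = suc M.
AboveE : ℕ → ℕ → Set
AboveE p q = ∃ λ M → q * suc (suc M) ^ suc (suc M) ≤ p * suc M ^ suc (suc M)

-- Coset leaders of weight at most D = diam 𝕋 realise all 2^d syndromes (⟨b i , -⟩)ᵢ of a basis
-- of V, so 2^d is at most the size of a Hamming ball of radius D.
-- For the second bound take a shortest walk with D steps: no set of its steps can be traded for
-- fewer generators with the same column sum. Hence the steps have distinct nonzero columns, the
-- ends of the K pairs at a step are never steps, and the two ends of a pair are not shared with
-- two different other steps. Charging the steps and the ends of their pairs to (column, side)
-- cells injectively gives 2D(K+1) ≤ 2n. Finally Σ_{i≤D} C(n,i) K^(n−D) ≤ (K+1)^n, which with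
-- (K+1)(n−D) ≥ Kn gives (Σ_{i≤D} C(n,i))^(K+1) ≤ ((K+1)(1+1/K)^K)^n, and (1+1/K)^K < e < p/q.

module Submission where

open import Defs
open import Level using (0ℓ)
open import Function using (_∘_)
open import Function.Bundles using (Inverse; Injection; _↣_; mk↣)
open import Function.Definitions using (Injective)
open import Function.Properties.Inverse using (↔-refl; ↔-sym; ↔-trans; ↔⇒↣)
open import Function.Properties.Injection using (↣-trans)
open import Data.Empty using (⊥-elim)
open import Data.Bool using (Bool; true; false; _xor_; _∧_; not)
import Data.Bool.Properties as BP
open import Data.Maybe using (just; nothing)
open import Data.Nat using (ℕ; zero; suc; _+_; _*_; _^_; _∸_; _≤_; _<_; s≤s; z≤n)
import Data.Nat.Properties as NP
open import Data.Nat.Combinatorics using (_C_; nCk+nC[k+1]≡[n+1]C[k+1])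
open import Data.Fin using (Fin; zero; suc; finToFun; funToFin; combine)
import Data.Fin.Properties as FP
open import Data.Vec.Functional using (tail) renaming (_∷_ to _◂_)
open import Data.List using (List; []; _∷_; length; map; _++_; lookup)
import Data.List.Properties as LP
open import Data.List.Relation.Unary.Any using (Any; here; there; index) renaming (map to Any-map)
import Data.List.Relation.Unary.Any.Properties as AnyP
open import Data.List.Relation.Unary.All using (All; []; _∷_)
open import Data.List.Relation.Unary.AllPairs using ([]; _∷_)
open import Data.List.Relation.Unary.Unique.Propositional using (Unique)
open import Data.Product using (∃; ∃₂; _×_; _,_; proj₁; proj₂; map₂)
open import Data.Product.Function.NonDependent.Propositional using (_×-↔_)
open import Data.Sum using (inj₁; inj₂)
open import Relation.Nullary using (¬_; Dec; yes; no; does; contradiction)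
open import Relation.Nullary.Decidable using (dec-true; dec-false; ¬?; _×-dec_; _⊎-dec_; map′)
open import Relation.Binary.Definitions using (tri<; tri≈; tri>)
open import Relation.Binary.PropositionalEquality
open import Data.Nat.Tactic.RingSolver using (solve-∀)
import Tactic.RingSolver as BoolSolver
import Tactic.RingSolver.Core.AlmostCommutativeRing as ACR

-- Linear algebra over 𝔽₂

𝔽₂ : ACR.AlmostCommutativeRing 0ℓ 0ℓ
𝔽₂ = ACR.fromCommutativeRing BP.xor-∧-commutativeRing λ { false → just refl ; true → nothing }

xor-cancelʳ : ∀ a b → (a xor b) xor b ≡ a
xor-cancelʳ = BoolSolver.solve-∀ 𝔽₂

xor-cancelˡ-≡ : ∀ s {a b} → s xor a ≡ s xor b → a ≡ b
xor-cancelˡ-≡ false eq = eq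
xor-cancelˡ-≡ true  eq = BP.not-injective eq

xor≡false⇒≡ : ∀ {a b} → a xor b ≡ false → a ≡ b
xor≡false⇒≡ {a} {b} eq = trans (sym (xor-cancelʳ a b)) (cong (_xor b) eq)

sumB-cong : ∀ {k} {f g : Fin k → Bool} → (∀ i → f i ≡ g i) → sumB f ≡ sumB g
sumB-cong {zero}  _   = refl
sumB-cong {suc k} f≗g = cong₂ _xor_ (f≗g zero) (sumB-cong (f≗g ∘ suc))

sumB-zero : ∀ k → sumB {k} (λ _ → false) ≡ false
sumB-zero zero    = refl
sumB-zero (suc k) = sumB-zero k

sumB-xor : ∀ {k} (f g : Fin k → Bool) → sumB (λ i → f i xor g i) ≡ sumB f xor sumB g
sumB-xor {zero}  f g = refl
sumB-xor {suc k} f g =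
  trans (cong ((f zero xor g zero) xor_) (sumB-xor (f ∘ suc) (g ∘ suc)))
        (interchange (f zero) (g zero) (sumB (f ∘ suc)) (sumB (g ∘ suc)))
  where
  interchange : ∀ a b c d → (a xor b) xor (c xor d) ≡ (a xor c) xor (b xor d)
  interchange = BoolSolver.solve-∀ 𝔽₂

∧-sumB : ∀ {k} b (f : Fin k → Bool) → b ∧ sumB f ≡ sumB (λ i → b ∧ f i)
∧-sumB {k} false f = sym (sumB-zero k)
∧-sumB     true  f = refl

sumB-∧ : ∀ {k} (f : Fin k → Bool) b → sumB f ∧ b ≡ sumB (λ i → f i ∧ b)
sumB-∧ f b = trans (BP.∧-comm (sumB f) b) (trans (∧-sumB b f) (sumB-cong λ i → BP.∧-comm b (f i)))

sumB-comm : ∀ {k l} (h : Fin k → Fin l → Bool) →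
            sumB (λ i → sumB (h i)) ≡ sumB (λ j → sumB (λ i → h i j))
sumB-comm {zero} {l} h = sym (sumB-zero l)
sumB-comm {suc k}    h = trans (cong (sumB (h zero) xor_) (sumB-comm (h ∘ suc)))
                               (sym (sumB-xor (h zero) (λ j → sumB (λ i → h (suc i) j))))

sumB-complement : ∀ {k} (P : Fin k → Bool) (h : Fin k → Bool) →
                  sumB (λ u → not (P u) ∧ h u) xor sumB (λ u → P u ∧ h u) ≡ sumB h
sumB-complement P h = trans (sym (sumB-xor (λ u → not (P u) ∧ h u) (λ u → P u ∧ h u))) (sumB-cong λ u → split (P u) (h u))
  where
  split : ∀ p a → (not p ∧ a) xor (p ∧ a) ≡ a
  split false a = BP.xor-identityʳ a
  split true  a = refl

infixr 25 _·ᵥ_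
_·ᵥ_ : ∀ {n} → Bool → BVec n → BVec n
(s ·ᵥ x) j = s ∧ x j

module _ {n : ℕ} where

  dot-cong : ∀ {x x′ y y′ : BVec n} → x ≈ᵥ x′ → y ≈ᵥ y′ → dot x y ≡ dot x′ y′
  dot-cong x≈x′ y≈y′ = sumB-cong λ j → cong₂ _∧_ (x≈x′ j) (y≈y′ j)

  dot-comm : ∀ (x y : BVec n) → dot x y ≡ dot y x
  dot-comm x y = sumB-cong λ j → BP.∧-comm (x j) (y j)

  dot-+ᵥʳ : ∀ (x y z : BVec n) → dot x (y +ᵥ z) ≡ dot x y xor dot x z
  dot-+ᵥʳ x y z = trans (sumB-cong λ j → BP.∧-distribˡ-xor (x j) (y j) (z j)) (sumB-xor {n} (λ j → x j ∧ y j) (λ j → x j ∧ z j))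

  dot-+ᵥˡ : ∀ (x y z : BVec n) → dot (x +ᵥ y) z ≡ dot x z xor dot y z
  dot-+ᵥˡ x y z = trans (dot-comm _ z)
    (trans (dot-+ᵥʳ z x y) (cong₂ _xor_ (dot-comm z x) (dot-comm z y)))

  dot-·ᵥʳ : ∀ s (x y : BVec n) → dot x (s ·ᵥ y) ≡ s ∧ dot x y
  dot-·ᵥʳ s x y = trans (sumB-cong λ j → swap (x j) s (y j)) (sym (∧-sumB {n} s (λ j → x j ∧ y j)))
    where
    swap : ∀ a b c → a ∧ (b ∧ c) ≡ b ∧ (a ∧ c)
    swap = BoolSolver.solve-∀ 𝔽₂

  dot-·ᵥˡ : ∀ s (x y : BVec n) → dot (s ·ᵥ x) y ≡ s ∧ dot x y
  dot-·ᵥˡ s x y = trans (dot-comm _ y) (trans (dot-·ᵥʳ s y x) (cong (s ∧_) (dot-comm y x)))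

  dot-0ᵥ : ∀ (x : BVec n) → dot x 0ᵥ ≡ false
  dot-0ᵥ x = trans (sumB-cong λ j → BP.∧-zeroʳ (x j)) (sumB-zero n)

dot-e : ∀ {n} (x : BVec n) i → dot x (e i) ≡ x i
dot-e {suc n} x zero    = begin
  x zero ∧ true xor sumB (λ j → x (suc j) ∧ false) ≡⟨ cong₂ _xor_ (BP.∧-identityʳ (x zero)) (dot-0ᵥ (tail x)) ⟩
  x zero xor false                                 ≡⟨ BP.xor-identityʳ (x zero) ⟩
  x zero                                           ∎
  where open ≡-Reasoning
dot-e {suc n} x (suc i) = trans (cong (_xor dot (tail x) (e i)) (BP.∧-zeroʳ (x zero))) (dot-e (tail x) i)

dot-lincomb : ∀ {k n} (b : Fin k → BVec n) c z →
              dot (lincomb b c) z ≡ sumB (λ i → c i ∧ dot (b i) z)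
dot-lincomb b c z = begin
  sumB (λ j → sumB (λ i → c i ∧ b i j) ∧ z j)   ≡⟨ sumB-cong (λ j → sumB-∧ (λ i → c i ∧ b i j) (z j)) ⟩
  sumB (λ j → sumB (λ i → (c i ∧ b i j) ∧ z j)) ≡⟨ sumB-comm (λ j i → (c i ∧ b i j) ∧ z j) ⟩
  sumB (λ i → sumB (λ j → (c i ∧ b i j) ∧ z j)) ≡⟨ sumB-cong (λ i → trans (sumB-cong λ j → BP.∧-assoc (c i) (b i j) (z j))
                                                                         (sym (∧-sumB (c i) (λ j → b i j ∧ z j)))) ⟩
  sumB (λ i → c i ∧ dot (b i) z)                 ∎
  where open ≡-Reasoning

rowSpace-dual : ∀ {m n} (A : Matrix m n) {z} → (∀ r → dot (A r) z ≡ false) → Dual (RowSpace A) z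
rowSpace-dual {m} A {z} Az≡0 u (c , Ac≈u) = begin
  dot u z                         ≡⟨ dot-cong (λ j → sym (Ac≈u j)) (λ _ → refl) ⟩
  dot (lincomb A c) z             ≡⟨ dot-lincomb A c z ⟩
  sumB (λ r → c r ∧ dot (A r) z)  ≡⟨ sumB-cong (λ r → trans (cong (c r ∧_) (Az≡0 r)) (BP.∧-zeroʳ (c r))) ⟩
  sumB {m} (λ _ → false)          ≡⟨ sumB-zero m ⟩
  false                           ∎
  where open ≡-Reasoning

dual-+ᵥ : ∀ {n} (V : Subspace n) {x y} → Dual V x → Dual V y → Dual V (x +ᵥ y)
dual-+ᵥ V {x} {y} x⊥V y⊥V u u∈V = trans (dot-+ᵥʳ u x y) (cong₂ _xor_ (x⊥V u u∈V) (y⊥V u u∈V))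

dual-cong : ∀ {n} (V : Subspace n) {x y} → x ≈ᵥ y → Dual V x → Dual V y
dual-cong V x≈y x⊥V u u∈V = trans (dot-cong (λ _ → refl) (λ j → sym (x≈y j))) (x⊥V u u∈V)

linIndep⇒pivot : ∀ {d n} (b : Fin (suc d) → BVec n) → LinIndep b → ∃ λ j → b zero j ≡ true
linIndep⇒pivot {d} {n} b indep = map₂ BP.¬-not (FP.¬∀⟶∃¬ n _ (λ j → b zero j BP.≟ false) b₀≢0)
  where
  b₀≢0 : ¬ (∀ j → b zero j ≡ false)
  b₀≢0 b₀≡0 with indep (λ { zero → true ; (suc _) → false })
                       (λ j → cong₂ _xor_ (b₀≡0 j) (sumB-zero d)) zero
  ... | ()

eliminate : ∀ {d n} → (Fin (suc d) → BVec n) → Fin n → Fin d → BVec n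
eliminate b j i = b (suc i) +ᵥ b (suc i) j ·ᵥ b zero

eliminate-pivot : ∀ {d n} (b : Fin (suc d) → BVec n) {j} → b zero j ≡ true → ∀ i → eliminate b j i j ≡ false
eliminate-pivot b {j} b₀j≡1 i = begin
  β xor (β ∧ b zero j) ≡⟨ cong (λ t → β xor (β ∧ t)) b₀j≡1 ⟩
  β xor (β ∧ true)     ≡⟨ cong (β xor_) (BP.∧-identityʳ β) ⟩
  β xor β              ≡⟨ BP.xor-same β ⟩
  false                ∎
  where
  open ≡-Reasoning
  β = b (suc i) j

eliminate-linIndep : ∀ {d n} (b : Fin (suc d) → BVec n) j → LinIndep b → LinIndep (eliminate b j)
eliminate-linIndep {d} b j indep c b′c≈0 i = indep (γ ◂ c) (λ k → trans (same-combination k) (b′c≈0 k)) (suc i)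
  where
  open ≡-Reasoning
  β : Fin d → Bool
  β i = b (suc i) j
  γ = sumB (λ i → c i ∧ β i)
  distrib : ∀ c x β z → c ∧ (x xor (β ∧ z)) ≡ (c ∧ x) xor ((c ∧ β) ∧ z)
  distrib = BoolSolver.solve-∀ 𝔽₂
  same-combination : ∀ k → lincomb b (γ ◂ c) k ≡ lincomb (eliminate b j) c k
  same-combination k = begin
    (γ ∧ b zero k) xor sumB (λ i → c i ∧ b (suc i) k)
      ≡⟨ BP.xor-comm (γ ∧ b zero k) _ ⟩
    sumB (λ i → c i ∧ b (suc i) k) xor (γ ∧ b zero k)
      ≡⟨ cong (sumB (λ i → c i ∧ b (suc i) k) xor_) (sumB-∧ {d} (λ i → c i ∧ β i) (b zero k)) ⟩
    sumB (λ i → c i ∧ b (suc i) k) xor sumB (λ i → (c i ∧ β i) ∧ b zero k)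
      ≡⟨ sym (sumB-xor {d} (λ i → c i ∧ b (suc i) k) (λ i → (c i ∧ β i) ∧ b zero k)) ⟩
    sumB (λ i → (c i ∧ b (suc i) k) xor ((c i ∧ β i) ∧ b zero k))
      ≡⟨ sumB-cong (λ i → sym (distrib (c i) (b (suc i) k) (β i) (b zero k))) ⟩
    lincomb (eliminate b j) c k ∎

-- Solve the eliminated system, then fix the first equation with the pivot coordinate.
linIndep⇒dot-surjective : ∀ {d n} (b : Fin d → BVec n) → LinIndep b →
                          (c : Fin d → Bool) → ∃ λ y → ∀ i → dot (b i) y ≡ c i
linIndep⇒dot-surjective {zero}      b _     c = 0ᵥ , λ ()
linIndep⇒dot-surjective {suc d} {n} b indep c = y , dot-b-y
  where
  open ≡-Reasoning
  j = proj₁ (linIndep⇒pivot b indep)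
  b₀j≡1 = proj₂ (linIndep⇒pivot b indep)
  b₀ = b zero
  b′ = eliminate b j

  β : Fin d → Bool
  β i = b (suc i) j

  c′ : Fin d → Bool
  c′ i = c (suc i) xor (β i ∧ c zero)

  y′ = proj₁ (linIndep⇒dot-surjective b′ (eliminate-linIndep b j indep) c′)
  s = c zero xor dot b₀ y′

  y : BVec n
  y = y′ +ᵥ s ·ᵥ e j

  dot-y : ∀ x → dot x y ≡ dot x y′ xor (s ∧ x j)
  dot-y x = trans (dot-+ᵥʳ x y′ _) (cong (dot x y′ xor_) (trans (dot-·ᵥʳ s x (e j)) (cong (s ∧_) (dot-e x j))))

  dot-b′-y : ∀ i → dot (b′ i) y ≡ c′ i
  dot-b′-y i = begin
    dot (b′ i) y                   ≡⟨ dot-y (b′ i) ⟩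
    dot (b′ i) y′ xor (s ∧ b′ i j) ≡⟨ cong₂ (λ u v → u xor (s ∧ v))
                                             (proj₂ (linIndep⇒dot-surjective b′ (eliminate-linIndep b j indep) c′) i)
                                             (eliminate-pivot b b₀j≡1 i) ⟩
    c′ i xor (s ∧ false)           ≡⟨ cong (c′ i xor_) (BP.∧-zeroʳ s) ⟩
    c′ i xor false                 ≡⟨ BP.xor-identityʳ (c′ i) ⟩
    c′ i                           ∎

  dot-b₀-y : dot b₀ y ≡ c zero
  dot-b₀-y = begin
    dot b₀ y                  ≡⟨ dot-y b₀ ⟩
    dot b₀ y′ xor (s ∧ b₀ j)  ≡⟨ cong (λ t → dot b₀ y′ xor (s ∧ t)) b₀j≡1 ⟩
    dot b₀ y′ xor (s ∧ true)  ≡⟨ fix (c zero) (dot b₀ y′) ⟩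
    c zero                    ∎
    where
    fix : ∀ c a → a xor ((c xor a) ∧ true) ≡ c
    fix = BoolSolver.solve-∀ 𝔽₂

  dot-b-y : ∀ i → dot (b i) y ≡ c i
  dot-b-y zero    = dot-b₀-y
  dot-b-y (suc i) = begin
    dot (b (suc i)) y                   ≡⟨ dot-cong (λ k → sym (xor-cancelʳ (b (suc i) k) (β i ∧ b₀ k))) (λ _ → refl) ⟩
    dot (b′ i +ᵥ β i ·ᵥ b₀) y           ≡⟨ dot-+ᵥˡ (b′ i) _ y ⟩
    dot (b′ i) y xor dot (β i ·ᵥ b₀) y  ≡⟨ cong₂ _xor_ (dot-b′-y i) (trans (dot-·ᵥˡ (β i) b₀ y) (cong (β i ∧_) dot-b₀-y)) ⟩
    c′ i xor (β i ∧ c zero)             ≡⟨ xor-cancelʳ (c (suc i)) (β i ∧ c zero) ⟩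
    c (suc i)                           ∎

-- Hamming weight and Hamming balls

boolToℕ : Bool → ℕ
boolToℕ false = 0
boolToℕ true  = 1

weight : ∀ {n} → BVec n → ℕ
weight {zero}  _ = 0
weight {suc n} x = boolToℕ (x zero) + weight (tail x)

weight-0ᵥ : ∀ n → weight {n} 0ᵥ ≡ 0
weight-0ᵥ zero    = refl
weight-0ᵥ (suc n) = weight-0ᵥ n

weight-e+ᵥ≤ : ∀ {n} (i : Fin n) (x : BVec n) → weight (e i +ᵥ x) ≤ suc (weight x)
weight-e+ᵥ≤ zero    x with x zero
... | false = NP.≤-refl
... | true  = NP.≤-trans (NP.n≤1+n _) (NP.n≤1+n _)
weight-e+ᵥ≤ (suc i) x = begin
  boolToℕ (x zero) + weight (e i +ᵥ tail x) ≤⟨ NP.+-monoʳ-≤ (boolToℕ (x zero)) (weight-e+ᵥ≤ i (tail x)) ⟩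
  boolToℕ (x zero) + suc (weight (tail x))  ≡⟨ NP.+-suc (boolToℕ (x zero)) _ ⟩
  suc (weight x)                            ∎
  where open NP.≤-Reasoning

weight-e+ᵥ-fresh : ∀ {n} (i : Fin n) (x : BVec n) → x i ≡ false → weight (e i +ᵥ x) ≡ suc (weight x)
weight-e+ᵥ-fresh zero    x xᵢ≡0 rewrite xᵢ≡0 = refl
weight-e+ᵥ-fresh (suc i) x xᵢ≡0 =
  trans (cong (boolToℕ (x zero) +_) (weight-e+ᵥ-fresh i (tail x) xᵢ≡0)) (NP.+-suc (boolToℕ (x zero)) _)

weight-sumGens≤length : ∀ {n} (w : List (Fin n)) → weight (sumGens w) ≤ length w
weight-sumGens≤length {n} []      = NP.≤-reflexive (weight-0ᵥ n)
weight-sumGens≤length     (i ∷ w) = NP.≤-trans (weight-e+ᵥ≤ i (sumGens w)) (s≤s (weight-sumGens≤length w))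

sumGens-∉ : ∀ {n} {i : Fin n} {w} → All (i ≢_) w → sumGens w i ≡ false
sumGens-∉ []                 = refl
sumGens-∉ {i = i} (j≢i ∷ i∉w) =
  cong₂ _xor_ (dec-false (_ FP.≟ i) (λ j≡i → j≢i (sym j≡i))) (sumGens-∉ i∉w)

weight-sumGens-unique : ∀ {n} {w : List (Fin n)} → Unique w → weight (sumGens w) ≡ length w
weight-sumGens-unique {n} []        = weight-0ᵥ n
weight-sumGens-unique {w = i ∷ w} (i∉w ∷ w!) =
  trans (weight-e+ᵥ-fresh i (sumGens w) (sumGens-∉ i∉w)) (cong suc (weight-sumGens-unique w!))

weight-complement : ∀ {k} (P : Fin k → Bool) → weight P + weight (not ∘ P) ≡ k
weight-complement {zero}  P = refl
weight-complement {suc k} P with P zero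
... | true  = cong suc (weight-complement (tail P))
... | false = trans (NP.+-suc (weight (tail P)) _) (cong suc (weight-complement (tail P)))

infix 4 _∈ᵥ_
_∈ᵥ_ : ∀ {n} → BVec n → List (BVec n) → Set
x ∈ᵥ xs = Any (x ≈ᵥ_) xs

index-injective : ∀ {n} {x y : BVec n} {xs} (x∈ : x ∈ᵥ xs) (y∈ : y ∈ᵥ xs) → index x∈ ≡ index y∈ → x ≈ᵥ y
index-injective (here x≈)  (here y≈)  _  j = trans (x≈ j) (sym (y≈ j))
index-injective (there x∈) (there y∈) eq   = index-injective x∈ y∈ (FP.suc-injective eq)

ball : ∀ n → ℕ → List (BVec n)
ball zero    _       = 0ᵥ ∷ []
ball (suc n) zero    = map (false ◂_) (ball n zero)
ball (suc n) (suc D) = map (false ◂_) (ball n (suc D)) ++ map (true ◂_) (ball n D)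

binSum-zero : ∀ D → binSum 0 D ≡ 1
binSum-zero zero    = refl
binSum-zero (suc D) = trans (NP.+-identityʳ _) (binSum-zero D)

binSum-pascal : ∀ n D → binSum (suc n) (suc D) ≡ binSum n (suc D) + binSum n D
binSum-pascal n zero = begin
  1 + suc n C 1      ≡⟨ cong (1 +_) (nCk+nC[k+1]≡[n+1]C[k+1] n 0) ⟨
  1 + (1 + n C 1)    ≡⟨ NP.+-comm 1 (1 + n C 1) ⟩
  (1 + n C 1) + 1    ∎
  where open ≡-Reasoning
binSum-pascal n (suc D) = begin
  binSum (suc n) (suc D) + suc n C suc (suc D)
    ≡⟨ cong₂ _+_ (binSum-pascal n D) (sym (nCk+nC[k+1]≡[n+1]C[k+1] n (suc D))) ⟩
  (binSum n (suc D) + binSum n D) + (n C suc D + n C suc (suc D))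
    ≡⟨ interchange (binSum n (suc D)) (binSum n D) (n C suc D) (n C suc (suc D)) ⟩
  (binSum n (suc D) + n C suc (suc D)) + (binSum n D + n C suc D)
    ∎
  where
  open ≡-Reasoning
  interchange : ∀ a b c d → (a + b) + (c + d) ≡ (a + d) + (b + c)
  interchange = solve-∀

length-ball : ∀ n D → length (ball n D) ≡ binSum n D
length-ball zero    D       = sym (binSum-zero D)
length-ball (suc n) zero    = trans (LP.length-map _ (ball n zero)) (length-ball n zero)
length-ball (suc n) (suc D) = begin
  length (map (false ◂_) (ball n (suc D)) ++ map (true ◂_) (ball n D))
    ≡⟨ LP.length-++ (map (false ◂_) (ball n (suc D))) ⟩
  length (map (false ◂_) (ball n (suc D))) + length (map (true ◂_) (ball n D))
    ≡⟨ cong₂ _+_ (trans (LP.length-map _ (ball n (suc D))) (length-ball n (suc D)))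
                 (trans (LP.length-map _ (ball n D)) (length-ball n D)) ⟩
  binSum n (suc D) + binSum n D
    ≡⟨ sym (binSum-pascal n D) ⟩
  binSum (suc n) (suc D) ∎
  where open ≡-Reasoning

◂-∈ᵥ : ∀ {n} {x : BVec (suc n)} {b xs} → x zero ≡ b → tail x ∈ᵥ xs → x ∈ᵥ map (b ◂_) xs
◂-∈ᵥ x₀≡b tail∈ = AnyP.map⁺ (Any-map (λ tail≈ → λ { zero → x₀≡b ; (suc j) → tail≈ j }) tail∈)

∈-ball : ∀ n D (x : BVec n) → weight x ≤ D → x ∈ᵥ ball n D
∈-ball zero    D x _ = here λ ()
∈-ball (suc n) D x wt≤D with x zero in x₀
∈-ball (suc n) zero    x wt≤D       | false = ◂-∈ᵥ x₀ (∈-ball n zero (tail x) wt≤D)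
∈-ball (suc n) (suc D) x wt≤D       | false = AnyP.++⁺ˡ (◂-∈ᵥ x₀ (∈-ball n (suc D) (tail x) wt≤D))
∈-ball (suc n) (suc D) x (s≤s wt≤D) | true  =
  AnyP.++⁺ʳ (map (false ◂_) (ball n (suc D))) (◂-∈ᵥ x₀ (∈-ball n D (tail x) wt≤D))

funToFin-cong : ∀ {m n} {f g : Fin m → Fin n} → (∀ i → f i ≡ g i) → funToFin f ≡ funToFin g
funToFin-cong {zero}  _   = refl
funToFin-cong {suc m} f≗g = cong₂ combine (f≗g zero) (funToFin-cong (f≗g ∘ suc))

dim≤binSum : ∀ {n d D} (V : Subspace n) → Dim V d → (∀ x y → DistLE V D x y) → 2 ^ d ≤ binSum n D
dim≤binSum {n} {d} {D} V (b , b∈V , indep , _) covers =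
  subst (2 ^ d ≤_) (length-ball n D) (FP.injective⇒≤ position-injective)
  where
  bit = Inverse.to FP.2↔Bool

  syndrome : Fin (2 ^ d) → Fin d → Bool
  syndrome k i = bit (finToFun {2} {d} k i)

  target : Fin (2 ^ d) → BVec n
  target k = proj₁ (linIndep⇒dot-surjective b indep (syndrome k))

  leader : Fin (2 ^ d) → BVec n
  leader k = sumGens (proj₁ (covers 0ᵥ (target k)))

  leader-syndrome : ∀ k i → dot (b i) (leader k) ≡ syndrome k i
  leader-syndrome k i = trans
    (xor≡false⇒≡ (trans (sym (dot-+ᵥʳ (b i) (leader k) (target k))) (proj₂ (proj₂ (covers 0ᵥ (target k))) (b i) (b∈V i))))
    (proj₂ (linIndep⇒dot-surjective b indep (syndrome k)) i)

  leader∈ball : ∀ k → leader k ∈ᵥ ball n D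
  leader∈ball k = ∈-ball n D (leader k)
    (NP.≤-trans (weight-sumGens≤length (proj₁ (covers 0ᵥ (target k)))) (proj₁ (proj₂ (covers 0ᵥ (target k)))))

  position : Fin (2 ^ d) → Fin (length (ball n D))
  position k = index (leader∈ball k)

  position-injective : Injective _≡_ _≡_ position
  position-injective {k} {k′} eq = begin
    k                              ≡⟨ FP.funToFin-finToFin {d} {2} k ⟨
    funToFin (finToFun {2} {d} k)  ≡⟨ funToFin-cong (λ i → Injection.injective (↔⇒↣ FP.2↔Bool) (same-syndrome i)) ⟩
    funToFin (finToFun {2} {d} k′) ≡⟨ FP.funToFin-finToFin {d} {2} k′ ⟩
    k′                             ∎
    where
    open ≡-Reasoning
    same-syndrome : ∀ i → syndrome k i ≡ syndrome k′ i
    same-syndrome i = begin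
      syndrome k i          ≡⟨ leader-syndrome k i ⟨
      dot (b i) (leader k)  ≡⟨ dot-cong (λ _ → refl) (index-injective (leader∈ball k) (leader∈ball k′) eq) ⟩
      dot (b i) (leader k′) ≡⟨ leader-syndrome k′ i ⟩
      syndrome k′ i         ∎

-- Shortest walks and the pair condition

any?ᵇ : ∀ {p} {P : Bool → Set p} → (∀ b → Dec (P b)) → Dec (∃ P)
any?ᵇ P? = map′ (λ { (inj₁ p) → false , p ; (inj₂ p) → true , p })
                (λ { (false , p) → inj₁ p ; (true , p) → inj₂ p })
                (P? false ⊎-dec P? true)

injection-×-Bool⇒≤ : ∀ {a b c} → ((Fin a × Fin b) × Bool) ↣ (Fin c × Bool) → a * b ≤ c
injection-×-Bool⇒≤ {a} {b} {c} g = NP.*-cancelʳ-≤ (a * b) c 2 (FP.injective⇒≤ (Injection.injective encoded))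
  where
  encoded : Fin (a * b * 2) ↣ Fin (c * 2)
  encoded = ↣-trans (↔⇒↣ (↔-trans (FP.*↔× {a * b} {2}) (FP.*↔× {a} {b} ×-↔ FP.2↔Bool)))
                    (↣-trans g (↔⇒↣ (↔-sym (↔-trans (FP.*↔× {c} {2}) (↔-refl ×-↔ FP.2↔Bool)))))

sumList : ∀ {k} → (Fin k → Bool) → List (Fin k) → Bool
sumList g []      = false
sumList g (i ∷ w) = g i xor sumList g w

sumList-++ : ∀ {k} (g : Fin k → Bool) u w → sumList g (u ++ w) ≡ sumList g u xor sumList g w
sumList-++ g []      w = refl
sumList-++ g (i ∷ u) w = trans (cong (g i xor_) (sumList-++ g u w)) (sym (BP.xor-assoc (g i) _ _))

sumList-lookup : ∀ {k} (g : Fin k → Bool) w → sumList g w ≡ sumB (g ∘ lookup w)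
sumList-lookup g []      = refl
sumList-lookup g (i ∷ w) = cong (g i xor_) (sumList-lookup g w)

dot-sumGens : ∀ {n} (x : BVec n) w → dot x (sumGens w) ≡ sumList x w
dot-sumGens x []      = dot-0ᵥ x
dot-sumGens x (i ∷ w) = trans (dot-+ᵥʳ x (e i) (sumGens w)) (cong₂ _xor_ (dot-e x i) (dot-sumGens x w))

select : ∀ {k n} → (Fin k → Fin n) → (Fin k → Bool) → List (Fin n)
select {zero}  f P = []
select {suc k} f P with P zero
... | true  = f zero ∷ select (f ∘ suc) (tail P)
... | false = select (f ∘ suc) (tail P)

length-select : ∀ {k n} (f : Fin k → Fin n) P → length (select f P) ≡ weight P
length-select {zero}  f P = refl
length-select {suc k} f P with P zero
... | true  = cong suc (length-select (f ∘ suc) (tail P))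
... | false = length-select (f ∘ suc) (tail P)

sumList-select : ∀ {k n} (g : Fin n → Bool) (f : Fin k → Fin n) P →
                 sumList g (select f P) ≡ sumB (λ u → P u ∧ g (f u))
sumList-select {zero}  g f P = refl
sumList-select {suc k} g f P with P zero
... | true  = cong (g (f zero) xor_) (sumList-select g (f ∘ suc) (tail P))
... | false = sumList-select g (f ∘ suc) (tail P)

module Geodesic {m n} (A : Matrix m n) {x y : BVec n} (w₀ : List (Fin n))
  (reaches : SameCoset (RowSpace A) (x +ᵥ sumGens w₀) y)
  (shortest : ∀ w → SameCoset (RowSpace A) (x +ᵥ sumGens w) y → length w₀ ≤ length w)
  where

  D : ℕ
  D = length w₀

  step : Fin D → Fin n
  step = lookup w₀

  -- Dropping the steps T and appending R gives a walk to the same coset.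
  no-shortcut : ∀ (T : List (Fin D)) → Unique T → (R : List (Fin n)) →
                (∀ r → sumList (A r ∘ step) T ≡ sumList (A r) R) → length T ≤ length R
  no-shortcut T T! R same = NP.+-cancelˡ-≤ (weight kept) (length T) (length R) lengths
    where
    kept : Fin D → Bool
    kept = not ∘ sumGens T

    w′ : List (Fin n)
    w′ = select step kept ++ R

    closes : ∀ r → dot (A r) (sumGens w₀ +ᵥ sumGens w′) ≡ false
    closes r = begin
      dot (A r) (sumGens w₀ +ᵥ sumGens w′)
        ≡⟨ dot-+ᵥʳ (A r) (sumGens w₀) (sumGens w′) ⟩
      dot (A r) (sumGens w₀) xor dot (A r) (sumGens w′)
        ≡⟨ cong₂ _xor_ (trans (dot-sumGens (A r) w₀) (sumList-lookup (A r) w₀))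
                       (trans (dot-sumGens (A r) w′) (sumList-++ (A r) (select step kept) R)) ⟩
      sumB h xor (sumList (A r) (select step kept) xor sumList (A r) R)
        ≡⟨ cong (sumB h xor_) (cong₂ _xor_ (sumList-select (A r) step kept) removed) ⟩
      sumB h xor (sumB (λ u → kept u ∧ h u) xor sumB (λ u → sumGens T u ∧ h u))
        ≡⟨ cong (sumB h xor_) (sumB-complement (sumGens T) h) ⟩
      sumB h xor sumB h
        ≡⟨ BP.xor-same (sumB h) ⟩
      false ∎
      where
      open ≡-Reasoning
      h = A r ∘ step
      removed : sumList (A r) R ≡ dot (sumGens T) h
      removed = trans (sym (same r)) (trans (sym (dot-sumGens h T)) (dot-comm h (sumGens T)))

    regroup : ∀ a b c d → ((a xor b) xor d) xor (b xor c) ≡ (a xor c) xor d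
    regroup = BoolSolver.solve-∀ 𝔽₂

    reaches′ : SameCoset (RowSpace A) (x +ᵥ sumGens w′) y
    reaches′ = dual-cong (RowSpace A) (λ j → regroup (x j) (sumGens w₀ j) (sumGens w′ j) (y j))
                 (dual-+ᵥ (RowSpace A) reaches (rowSpace-dual A closes))

    lengths : weight kept + length T ≤ weight kept + length R
    lengths = begin
      weight kept + length T                ≡⟨ cong (weight kept +_) (weight-sumGens-unique T!) ⟨
      weight kept + weight (sumGens T)      ≡⟨ NP.+-comm (weight kept) _ ⟩
      weight (sumGens T) + weight kept      ≡⟨ weight-complement (sumGens T) ⟩
      D                                     ≤⟨ shortest w′ reaches′ ⟩
      length w′                             ≡⟨ LP.length-++ (select step kept) ⟩
      length (select step kept) + length R  ≡⟨ cong (_+ length R) (length-select step kept) ⟩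
      weight kept + length R                ∎
      where open NP.≤-Reasoning

  column-nonzero : ∀ t → ¬ column A (step t) ≈ᵥ 0ᵥ
  column-nonzero t col≈0 =
    NP.1+n≰n (no-shortcut (t ∷ []) ([] ∷ []) [] λ r → cong (_xor false) (col≈0 r))

  step-injective : ∀ {t t′} → step t ≡ step t′ → t ≡ t′
  step-injective {t} {t′} eq with t FP.≟ t′
  ... | yes t≡t′ = t≡t′
  ... | no  t≢t′ = contradiction (no-shortcut (t ∷ t′ ∷ []) ((t≢t′ ∷ []) ∷ [] ∷ []) [] cancels) λ ()
    where
    twice : ∀ a → a xor (a xor false) ≡ false
    twice = BoolSolver.solve-∀ 𝔽₂
    cancels : ∀ r → A r (step t) xor (A r (step t′) xor false) ≡ false
    cancels r = trans (cong (λ j → A r (step t) xor (A r j xor false)) (sym eq)) (twice (A r (step t)))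

  module Pairs {K} (pc : PairCondition A K) where

    pair : Fin D → Fin K → Fin n × Fin n
    pair t = proj₁ (pc (step t) (column-nonzero t))

    end : Fin D → Fin K → Bool → Fin n
    end t a false = proj₁ (pair t a)
    end t a true  = proj₂ (pair t a)

    avoiding : ∀ t a → PairAvoiding (step t) (pair t a)
    avoiding t = proj₁ (proj₂ (pc (step t) (column-nonzero t)))

    disjoint : ∀ t {a a′} → a ≢ a′ → Disjoint (pair t a) (pair t a′)
    disjoint t {a} {a′} = proj₂ (proj₂ (proj₂ (pc (step t) (column-nonzero t)))) a a′

    column-split : ∀ t a b r → A r (step t) ≡ A r (end t a b) xor A r (end t a (not b))
    column-split t a false r = proj₁ (proj₂ (proj₂ (pc (step t) (column-nonzero t)))) a r
    column-split t a true  r = trans (column-split t a false r) (BP.xor-comm (A r (end t a false)) _)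

    end≢partner : ∀ t a b → end t a b ≢ end t a (not b)
    end≢partner t a false = proj₁ (avoiding t a)
    end≢partner t a true  = proj₁ (avoiding t a) ∘ sym

    end≢step : ∀ t a b → end t a b ≢ step t
    end≢step t a false = proj₁ (proj₂ (avoiding t a))
    end≢step t a true  = proj₂ (proj₂ (avoiding t a))

    end-injective : ∀ {t a a′ b b′} → end t a b ≡ end t a′ b′ → a ≡ a′ × b ≡ b′
    end-injective {t} {a} {a′} {b} {b′} eq with a FP.≟ a′
    ... | yes refl = refl , same-side b b′ eq
      where
      same-side : ∀ b b′ → end t a b ≡ end t a b′ → b ≡ b′
      same-side false false _  = refl
      same-side true  true  _  = refl
      same-side false true  eq = ⊥-elim (end≢partner t a false eq)
      same-side true  false eq = ⊥-elim (end≢partner t a true eq)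
    ... | no a≢a′ = ⊥-elim (disjoint-ends b b′ eq)
      where
      disjoint-ends : ∀ b b′ → end t a b ≢ end t a′ b′
      disjoint-ends false false = proj₁ (disjoint t a≢a′)
      disjoint-ends false true  = proj₁ (proj₂ (disjoint t a≢a′))
      disjoint-ends true  false = proj₁ (proj₂ (proj₂ (disjoint t a≢a′)))
      disjoint-ends true  true  = proj₂ (proj₂ (proj₂ (disjoint t a≢a′)))

    Endpoint : Fin n → Fin D → Set
    Endpoint c t = ∃₂ λ a b → end t a b ≡ c

    step≢end : ∀ t′ t a b → step t′ ≢ end t a b
    step≢end t′ t a b eq = NP.1+n≰n (no-shortcut (t ∷ t′ ∷ []) ((t≢t′ ∷ []) ∷ [] ∷ []) (end t a (not b) ∷ []) same)
      where
      open ≡-Reasoning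
      t≢t′ : t ≢ t′
      t≢t′ refl = end≢step t a b (sym eq)
      cancel : ∀ v u → (v xor u) xor (v xor false) ≡ u xor false
      cancel = BoolSolver.solve-∀ 𝔽₂
      same : ∀ r → A r (step t) xor (A r (step t′) xor false) ≡ A r (end t a (not b)) xor false
      same r = begin
        A r (step t) xor (A r (step t′) xor false)
          ≡⟨ cong₂ (λ u v → u xor (A r v xor false)) (column-split t a b r) eq ⟩
        (A r (end t a b) xor A r (end t a (not b))) xor (A r (end t a b) xor false)
          ≡⟨ cancel (A r (end t a b)) (A r (end t a (not b))) ⟩
        A r (end t a (not b)) xor false ∎

    shared-ends-same-position : ∀ {t a b t₁ t₂} → t₁ ≢ t → Endpoint (end t a b) t₁ →
                                t₂ ≢ t → Endpoint (end t a (not b)) t₂ → t₁ ≡ t₂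
    shared-ends-same-position {t} {a} {b} {t₁} {t₂} t₁≢t (a₁ , b₁ , e₁) t₂≢t (a₂ , b₂ , e₂) with t₁ FP.≟ t₂
    ... | yes t₁≡t₂ = t₁≡t₂
    ... | no  t₁≢t₂ = ⊥-elim (NP.1+n≰n (no-shortcut (t ∷ t₁ ∷ t₂ ∷ []) distinct (x₁ ∷ x₂ ∷ []) same))
      where
      open ≡-Reasoning
      x₁ = end t₁ a₁ (not b₁)
      x₂ = end t₂ a₂ (not b₂)
      distinct : Unique (t ∷ t₁ ∷ t₂ ∷ [])
      distinct = ((t₁≢t ∘ sym) ∷ (t₂≢t ∘ sym) ∷ []) ∷ (t₁≢t₂ ∷ []) ∷ [] ∷ []
      cancel : ∀ v u z₁ z₂ → (v xor u) xor ((v xor z₁) xor ((u xor z₂) xor false)) ≡ z₁ xor (z₂ xor false)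
      cancel = BoolSolver.solve-∀ 𝔽₂
      same : ∀ r → A r (step t) xor (A r (step t₁) xor (A r (step t₂) xor false)) ≡ A r x₁ xor (A r x₂ xor false)
      same r = begin
        A r (step t) xor (A r (step t₁) xor (A r (step t₂) xor false))
          ≡⟨ cong₂ _xor_ (column-split t a b r)
               (cong₂ (λ u v → u xor (v xor false))
                 (trans (column-split t₁ a₁ b₁ r) (cong (λ c → A r c xor A r x₁) e₁))
                 (trans (column-split t₂ a₂ b₂ r) (cong (λ c → A r c xor A r x₂) e₂))) ⟩
        (A r (end t a b) xor A r (end t a (not b))) xor
          ((A r (end t a b) xor A r x₁) xor ((A r (end t a (not b)) xor A r x₂) xor false))
          ≡⟨ cancel (A r (end t a b)) (A r (end t a (not b))) (A r x₁) (A r x₂) ⟩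
        A r x₁ xor (A r x₂ xor false) ∎

    Shared : Fin n → Fin D → Set
    Shared c t = ∃ λ t′ → t′ ≢ t × Endpoint c t′

    shared? : ∀ c t → Dec (Shared c t)
    shared? c t = FP.any? λ t′ → ¬? (t′ FP.≟ t) ×-dec FP.any? λ a → any?ᵇ λ b → end t′ a b FP.≟ c

    slot : Fin D → Fin D → Bool
    slot t t′ = does (t FP.<? t′)

    slot-asym : ∀ {t t′} → t ≢ t′ → slot t t′ ≢ slot t′ t
    slot-asym {t} {t′} t≢t′ with FP.<-cmp t t′
    ... | tri< t<t′ _ t′≮t rewrite dec-true (t FP.<? t′) t<t′ | dec-false (t′ FP.<? t) t′≮t = λ ()
    ... | tri≈ _ t≡t′ _    = contradiction t≡t′ t≢t′
    ... | tri> t≮t′ _ t′<t rewrite dec-false (t FP.<? t′) t≮t′ | dec-true (t′ FP.<? t) t′<t = λ ()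

    -- An end used by t alone is charged to its own cell (end , false). A shared end passes its
    -- charge to its partner's cell (partner , true) when the partner is used by t alone; when both
    -- ends are shared they are shared with one and the same t′ (shared-ends-same-position), and t
    -- and t′ split the cells of the end by slot.
    chargeWith : ∀ t a b → Dec (Shared (end t a b) t) → Dec (Shared (end t a (not b)) t) → Fin n × Bool
    chargeWith t a b (no _)          _       = end t a b , false
    chargeWith t a b (yes _)         (no _)  = end t a (not b) , true
    chargeWith t a b (yes (t′ , _))  (yes _) = end t a b , slot t t′

    charge : Fin D → Fin K → Bool → Fin n × Bool
    charge t a b = chargeWith t a b (shared? (end t a b) t) (shared? (end t a (not b)) t)

    chargeWith-endpoint : ∀ t a b d d′ → Endpoint (proj₁ (chargeWith t a b d d′)) t
    chargeWith-endpoint t a b (no _)  _       = a , b , refl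
    chargeWith-endpoint t a b (yes _) (no _)  = a , not b , refl
    chargeWith-endpoint t a b (yes _) (yes _) = a , b , refl

    chargeWith-unshared : ∀ t a b d d′ → ¬ Shared (proj₁ (chargeWith t a b d d′)) t →
                          proj₁ (chargeWith t a b d d′) ≡ end t a (proj₂ (chargeWith t a b d d′) xor b)
    chargeWith-unshared t a b (no _)      _       _     = refl
    chargeWith-unshared t a b (yes _)     (no _)  _     = refl
    chargeWith-unshared t a b (yes shared) (yes _) ¬shared = contradiction shared ¬shared

    chargeWith-shared : ∀ t a b d d′ → Shared (proj₁ (chargeWith t a b d d′)) t →
                        proj₁ (chargeWith t a b d d′) ≡ end t a b ×
                        (∀ {t″} → t″ ≢ t → Endpoint (proj₁ (chargeWith t a b d d′)) t″ →
                                  proj₂ (chargeWith t a b d d′) ≡ slot t t″)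
    chargeWith-shared t a b (no ¬shared) _ shared = contradiction shared ¬shared
    chargeWith-shared t a b (yes _) (no ¬shared) shared = contradiction shared ¬shared
    chargeWith-shared t a b (yes (t′ , t′≢t , ep′)) (yes (t‴ , t‴≢t , ep‴)) _ =
      refl , λ t″≢t ep″ → cong (slot t) (trans (shared-ends-same-position {a = a} {b} t′≢t ep′ t‴≢t ep‴)
                                               (sym (shared-ends-same-position {a = a} {b} t″≢t ep″ t‴≢t ep‴)))

    charge-endpoint : ∀ t a b → Endpoint (proj₁ (charge t a b)) t
    charge-endpoint t a b = chargeWith-endpoint t a b (shared? (end t a b) t) (shared? (end t a (not b)) t)

    charge-unshared : ∀ t a b → ¬ Shared (proj₁ (charge t a b)) t →
                      proj₁ (charge t a b) ≡ end t a (proj₂ (charge t a b) xor b)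
    charge-unshared t a b = chargeWith-unshared t a b (shared? (end t a b) t) (shared? (end t a (not b)) t)

    charge-shared : ∀ t a b → Shared (proj₁ (charge t a b)) t →
                    proj₁ (charge t a b) ≡ end t a b ×
                    (∀ {t″} → t″ ≢ t → Endpoint (proj₁ (charge t a b)) t″ → proj₂ (charge t a b) ≡ slot t t″)
    charge-shared t a b = chargeWith-shared t a b (shared? (end t a b) t) (shared? (end t a (not b)) t)

    charge-separates-positions : ∀ {t₁ a₁ b₁ t₂ a₂ b₂} → t₁ ≢ t₂ → charge t₁ a₁ b₁ ≢ charge t₂ a₂ b₂
    charge-separates-positions {t₁} {a₁} {b₁} {t₂} {a₂} {b₂} t₁≢t₂ eq =
      slot-asym t₁≢t₂ (begin
        slot t₁ t₂                  ≡⟨ proj₂ (charge-shared t₁ a₁ b₁ shared₁) (t₁≢t₂ ∘ sym) ep₁₂ ⟨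
        proj₂ (charge t₁ a₁ b₁)     ≡⟨ cong proj₂ eq ⟩
        proj₂ (charge t₂ a₂ b₂)     ≡⟨ proj₂ (charge-shared t₂ a₂ b₂ shared₂) t₁≢t₂ ep₂₁ ⟩
        slot t₂ t₁                  ∎)
      where
      open ≡-Reasoning
      ep₁₂ : Endpoint (proj₁ (charge t₁ a₁ b₁)) t₂
      ep₁₂ = map₂ (map₂ (λ end≡ → trans end≡ (sym (cong proj₁ eq)))) (charge-endpoint t₂ a₂ b₂)
      ep₂₁ : Endpoint (proj₁ (charge t₂ a₂ b₂)) t₁
      ep₂₁ = map₂ (map₂ (λ end≡ → trans end≡ (cong proj₁ eq))) (charge-endpoint t₁ a₁ b₁)
      shared₁ : Shared (proj₁ (charge t₁ a₁ b₁)) t₁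
      shared₁ = t₂ , t₁≢t₂ ∘ sym , ep₁₂
      shared₂ : Shared (proj₁ (charge t₂ a₂ b₂)) t₂
      shared₂ = t₁ , t₁≢t₂ , ep₂₁

    charge-injective-at : ∀ {t a₁ b₁ a₂ b₂} → charge t a₁ b₁ ≡ charge t a₂ b₂ → a₁ ≡ a₂ × b₁ ≡ b₂
    charge-injective-at {t} {a₁} {b₁} {a₂} {b₂} eq = by-sharing (shared? c t)
      where
      open ≡-Reasoning
      c = proj₁ (charge t a₁ b₁)
      s = proj₂ (charge t a₁ b₁)
      c≡ : c ≡ proj₁ (charge t a₂ b₂)
      c≡ = cong proj₁ eq
      by-sharing : Dec (Shared c t) → a₁ ≡ a₂ × b₁ ≡ b₂
      by-sharing (yes shared) = end-injective (begin
        end t a₁ b₁              ≡⟨ proj₁ (charge-shared t a₁ b₁ shared) ⟨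
        c                        ≡⟨ c≡ ⟩
        proj₁ (charge t a₂ b₂)   ≡⟨ proj₁ (charge-shared t a₂ b₂ (subst (λ c → Shared c t) c≡ shared)) ⟩
        end t a₂ b₂              ∎)
      by-sharing (no ¬shared) = map₂ (xor-cancelˡ-≡ s) (end-injective (begin
        end t a₁ (s xor b₁)                      ≡⟨ charge-unshared t a₁ b₁ ¬shared ⟨
        c                                        ≡⟨ c≡ ⟩
        proj₁ (charge t a₂ b₂)                   ≡⟨ charge-unshared t a₂ b₂ (¬shared ∘ subst (λ c → Shared c t) (sym c≡)) ⟩
        end t a₂ (proj₂ (charge t a₂ b₂) xor b₂) ≡⟨ cong (λ s′ → end t a₂ (s′ xor b₂)) (cong proj₂ eq) ⟨
        end t a₂ (s xor b₂)                      ∎))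

    step≢charge : ∀ t′ t a b → step t′ ≢ proj₁ (charge t a b)
    step≢charge t′ t a b eq = step≢end t′ t (proj₁ ep) (proj₁ (proj₂ ep)) (trans eq (sym (proj₂ (proj₂ ep))))
      where
      ep = charge-endpoint t a b

    cell : (Fin D × Fin (suc K)) × Bool → Fin n × Bool
    cell ((t , zero)  , b) = step t , b
    cell ((t , suc a) , b) = charge t a b

    cell-injective : Injective _≡_ _≡_ cell
    cell-injective {(t₁ , zero) , b₁} {(t₂ , zero) , b₂} eq =
      cong₂ _,_ (cong₂ _,_ (step-injective (cong proj₁ eq)) refl) (cong proj₂ eq)
    cell-injective {(t₁ , zero) , b₁} {(t₂ , suc a₂) , b₂} eq = ⊥-elim (step≢charge t₁ t₂ a₂ b₂ (cong proj₁ eq))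
    cell-injective {(t₁ , suc a₁) , b₁} {(t₂ , zero) , b₂} eq = ⊥-elim (step≢charge t₂ t₁ a₁ b₁ (sym (cong proj₁ eq)))
    cell-injective {(t₁ , suc a₁) , b₁} {(t₂ , suc a₂) , b₂} eq = by-position (t₁ FP.≟ t₂)
      where
      by-position : Dec (t₁ ≡ t₂) → ((t₁ , suc a₁) , b₁) ≡ ((t₂ , suc a₂) , b₂)
      by-position (no t₁≢t₂)  = contradiction eq (charge-separates-positions t₁≢t₂)
      by-position (yes t₁≡t₂) = cong₂ _,_ (cong₂ _,_ t₁≡t₂ (cong suc (proj₁ same))) (proj₂ same)
        where
        same = charge-injective-at (subst (λ t → charge t₁ a₁ b₁ ≡ charge t a₂ b₂) (sym t₁≡t₂) eq)

    length*suc-K≤n : D * suc K ≤ n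
    length*suc-K≤n = injection-×-Bool⇒≤ (mk↣ cell-injective)

diameter*suc-K≤n : ∀ {m n} (A : Matrix m n) K → PairCondition A K →
                   ∀ D → IsDiameter (RowSpace A) D → D * suc K ≤ n
diameter*suc-K≤n {n = n} A K pc D (covers , x , y , far) =
  subst (λ l → l * suc K ≤ n) length-w₀≡D (Geodesic.Pairs.length*suc-K≤n A {x} {y} w₀ reaches shortest pc)
  where
  w₀ = proj₁ (covers x y)
  reaches = proj₂ (proj₂ (covers x y))
  length-w₀≤D = proj₁ (proj₂ (covers x y))

  D≤length : ∀ w → SameCoset (RowSpace A) (x +ᵥ sumGens w) y → D ≤ length w
  D≤length w reaches-w = NP.≮⇒≥ λ w<D → far (length w) w<D (w , NP.≤-refl , reaches-w)

  shortest : ∀ w → SameCoset (RowSpace A) (x +ᵥ sumGens w) y → length w₀ ≤ length w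
  shortest w reaches-w = NP.≤-trans length-w₀≤D (D≤length w reaches-w)

  length-w₀≡D : length w₀ ≡ D
  length-w₀≡D = NP.≤-antisym length-w₀≤D (D≤length w₀ reaches)

-- Estimates for binomial sums

^-distrib-* : ∀ a b n → (a * b) ^ n ≡ a ^ n * b ^ n
^-distrib-* a b zero    = refl
^-distrib-* a b (suc n) = trans (cong ((a * b) *_) (^-distrib-* a b n)) (interchange a b (a ^ n) (b ^ n))
  where
  interchange : ∀ a b c d → (a * b) * (c * d) ≡ (a * c) * (b * d)
  interchange = solve-∀

-- (1 + 1/x)^(m+1) ≥ 1 + (m+1)/x
bernoulli-lower : ∀ x m → x ^ suc m + suc m * x ^ m ≤ suc x ^ suc m
bernoulli-lower x zero    = NP.≤-reflexive (shape x)
  where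
  shape : ∀ x → x * 1 + 1 ≡ suc x * 1
  shape = solve-∀
bernoulli-lower x (suc m) = begin
  x ^ suc (suc m) + suc (suc m) * x ^ suc m                     ≤⟨ NP.m≤m+n _ (suc m * x ^ m) ⟩
  x * (x * x ^ m) + suc (suc m) * (x * x ^ m) + suc m * x ^ m  ≡⟨ expand x (x ^ m) m ⟩
  suc x * (x ^ suc m + suc m * x ^ m)                           ≤⟨ NP.*-monoʳ-≤ (suc x) (bernoulli-lower x m) ⟩
  suc x ^ suc (suc m)                                           ∎
  where
  open NP.≤-Reasoning
  expand : ∀ x p m → x * (x * p) + suc (suc m) * (x * p) + suc m * p ≡ suc x * (x * p + suc m * p)
  expand = solve-∀

-- (1 − 1/(y+1))^(m+1) ≥ 1 − (m+1)/(y+1)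
bernoulli-upper : ∀ y m → suc y ^ suc m ≤ y ^ suc m + suc m * suc y ^ m
bernoulli-upper y zero    = NP.≤-reflexive (shape y)
  where
  shape : ∀ y → suc y * 1 ≡ y * 1 + 1
  shape = solve-∀
bernoulli-upper y (suc m) = begin
  suc y * suc y ^ suc m                                   ≤⟨ NP.*-monoʳ-≤ (suc y) (bernoulli-upper y m) ⟩
  suc y * (y ^ suc m + suc m * suc y ^ m)                 ≡⟨ expand y (y ^ m) (suc y ^ m) m ⟩
  y ^ suc (suc m) + y ^ suc m + suc m * suc y ^ suc m     ≤⟨ NP.+-monoˡ-≤ (suc m * suc y ^ suc m)
                                                               (NP.+-monoʳ-≤ (y ^ suc (suc m)) (NP.^-monoˡ-≤ (suc m) (NP.n≤1+n y))) ⟩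
  y ^ suc (suc m) + suc y ^ suc m + suc m * suc y ^ suc m ≡⟨ collect (y ^ suc (suc m)) (suc y ^ suc m) (suc m) ⟩
  y ^ suc (suc m) + suc (suc m) * suc y ^ suc m           ∎
  where
  open NP.≤-Reasoning
  expand : ∀ y p q m → suc y * (y * p + suc m * q) ≡ y * (y * p) + y * p + suc m * (suc y * q)
  expand = solve-∀
  collect : ∀ a b c → a + b + c * b ≡ a + suc c * b
  collect = solve-∀

-- (1 + 1/K)^K ≤ (1 + 1/L)^L for L = K (N+1)
compound-interest-mono : ∀ K N → let L = K * suc N in suc K ^ K * L ^ L ≤ K ^ K * suc L ^ L
compound-interest-mono K N = begin
    suc K ^ K * L ^ L           ≡⟨ cong (λ t → suc K ^ K * L ^ t) (NP.*-comm K M) ⟩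
    suc K ^ K * L ^ (M * K)     ≡⟨ cong (suc K ^ K *_) (NP.^-*-assoc L M K) ⟨
    suc K ^ K * (L ^ M) ^ K     ≡⟨ ^-distrib-* (suc K) (L ^ M) K ⟨
    (suc K * L ^ M) ^ K         ≤⟨ NP.^-monoˡ-≤ K one-step ⟩
    (K * suc L ^ M) ^ K         ≡⟨ ^-distrib-* K (suc L ^ M) K ⟩
    K ^ K * (suc L ^ M) ^ K     ≡⟨ cong (K ^ K *_) (NP.^-*-assoc (suc L) M K) ⟩
    K ^ K * suc L ^ (M * K)     ≡⟨ cong (λ t → K ^ K * suc L ^ t) (NP.*-comm M K) ⟩
    K ^ K * suc L ^ L           ∎
  where
  open NP.≤-Reasoning
  M = suc N
  L = K * M
  expand : ∀ K M P → suc K * ((K * M) * P) ≡ K * ((K * M) * P + M * P)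
  expand = solve-∀
  one-step : suc K * L ^ M ≤ K * suc L ^ M
  one-step = begin
    suc K * L ^ M              ≡⟨ expand K M (L ^ N) ⟩
    K * (L ^ M + M * L ^ N)    ≤⟨ NP.*-monoʳ-≤ K (bernoulli-lower L N) ⟩
    K * suc L ^ M              ∎

-- (1 + 1/(L−1))^L ≤ (1 + 1/N)^(N+1) for L = K (N+1), K ≥ 1
compound-interest-upper-antitone : ∀ k N → let M = suc N ; L = suc k * M in
                                   N ^ M * L ^ L ≤ M ^ M * (N + k * M) ^ L
compound-interest-upper-antitone k N = begin
    N ^ M * L ^ L           ≡⟨ cong (N ^ M *_) (NP.^-*-assoc L K M) ⟨
    N ^ M * (L ^ K) ^ M     ≡⟨ ^-distrib-* N (L ^ K) M ⟨
    (N * L ^ K) ^ M         ≤⟨ NP.^-monoˡ-≤ M one-step ⟩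
    (M * l ^ K) ^ M         ≡⟨ ^-distrib-* M (l ^ K) M ⟩
    M ^ M * (l ^ K) ^ M     ≡⟨ cong (M ^ M *_) (NP.^-*-assoc l K M) ⟩
    M ^ M * l ^ L           ∎
  where
  open NP.≤-Reasoning
  K = suc k
  M = suc N
  L = K * M
  l = N + k * M
  regroup : ∀ M K P → M * (K * P) ≡ (K * M) * P
  regroup = solve-∀
  one-step-padded : L ^ K + N * L ^ K ≤ M * l ^ K + L ^ K
  one-step-padded = begin
    M * L ^ K                      ≤⟨ NP.*-monoʳ-≤ M (bernoulli-upper l k) ⟩
    M * (l ^ K + K * L ^ k)        ≡⟨ NP.*-distribˡ-+ M (l ^ K) (K * L ^ k) ⟩
    M * l ^ K + M * (K * L ^ k)    ≡⟨ cong (M * l ^ K +_) (regroup M K (L ^ k)) ⟩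
    M * l ^ K + L ^ K              ∎
  one-step : N * L ^ K ≤ M * l ^ K
  one-step = NP.+-cancelʳ-≤ (L ^ K) (N * L ^ K) (M * l ^ K)
               (subst (_≤ M * l ^ K + L ^ K) (NP.+-comm (L ^ K) (N * L ^ K)) one-step-padded)

-- (1 + 1/K)^K ≤ (1 + 1/N)^(N+1) for K, N ≥ 1
compound-interest≤upper : ∀ k N → let K = suc k ; N′ = suc N in
                  suc K ^ K * N′ ^ suc N′ ≤ K ^ K * suc N′ ^ suc N′
compound-interest≤upper k N = NP.*-cancelʳ-≤ (suc K ^ K * N′ ^ M) (K ^ K * M ^ M) (L ^ L * L ^ L) {{L^L*L^L≢0}} (begin
    suc K ^ K * N′ ^ M * (L ^ L * L ^ L)        ≡⟨ interchange (suc K ^ K) (N′ ^ M) (L ^ L) (L ^ L) ⟩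
    (suc K ^ K * L ^ L) * (N′ ^ M * L ^ L)      ≤⟨ NP.*-mono-≤ (compound-interest-mono K N′)
                                                                (compound-interest-upper-antitone k N′) ⟩
    (K ^ K * suc L ^ L) * (M ^ M * l ^ L)       ≡⟨ interchange (K ^ K) (suc L ^ L) (M ^ M) (l ^ L) ⟩
    (K ^ K * M ^ M) * (suc L ^ L * l ^ L)       ≤⟨ NP.*-monoʳ-≤ (K ^ K * M ^ M) below-square ⟩
    K ^ K * M ^ M * (L ^ L * L ^ L)             ∎)
  where
  open NP.≤-Reasoning
  K = suc k
  N′ = suc N
  M = suc N′
  L = K * M
  l = N′ + k * M
  L^L*L^L≢0 = NP.m*n≢0 (L ^ L) (L ^ L) {{NP.m^n≢0 L L}} {{NP.m^n≢0 L L}}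
  interchange : ∀ a b c d → (a * b) * (c * d) ≡ (a * c) * (b * d)
  interchange = solve-∀
  square : ∀ l → suc (suc l) * l + 1 ≡ suc l * suc l
  square = solve-∀
  -- (L + 1)(L − 1) < L²
  below-square : suc L ^ L * l ^ L ≤ L ^ L * L ^ L
  below-square = begin
    suc L ^ L * l ^ L        ≡⟨ ^-distrib-* (suc L) l L ⟨
    (suc L * l) ^ L          ≤⟨ NP.^-monoˡ-≤ L (subst (suc L * l ≤_) (square l) (NP.m≤m+n _ 1)) ⟩
    (L * L) ^ L              ≡⟨ ^-distrib-* L L L ⟩
    L ^ L * L ^ L            ∎

-- (1 + 1/K)^K < e < p/q
compound-interest≤aboveE : ∀ k {p q} → AboveE p q → suc (suc k) ^ suc k * q ≤ suc k ^ suc k * p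
compound-interest≤aboveE k {p} {q} (N , q*below≤p*above) =
  NP.*-cancelʳ-≤ (X * q) (Y * p) (a * b) {{NP.m*n≢0 a b {{NP.m^n≢0 (suc N) (suc (suc N))}} {{NP.m^n≢0 (suc (suc N)) (suc (suc N))}}}} (begin
    (X * q) * (a * b)   ≡⟨ regroup₁ X q a b ⟩
    (X * a) * (q * b)   ≤⟨ NP.*-mono-≤ (compound-interest≤upper k N) q*below≤p*above ⟩
    (Y * b) * (p * a)   ≡⟨ regroup₂ Y b p a ⟩
    (Y * p) * (a * b)   ∎)
  where
  open NP.≤-Reasoning
  X = suc (suc k) ^ suc k
  Y = suc k ^ suc k
  a = suc N ^ suc (suc N)
  b = suc (suc N) ^ suc (suc N)
  regroup₁ : ∀ X q a b → (X * q) * (a * b) ≡ (X * a) * (q * b)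
  regroup₁ = solve-∀
  regroup₂ : ∀ Y b p a → (Y * b) * (p * a) ≡ (Y * p) * (a * b)
  regroup₂ = solve-∀

^-∸-step : ∀ k n D → suc k ^ (n ∸ D) ≤ suc k * suc k ^ (n ∸ suc D)
^-∸-step k zero    zero    = s≤s z≤n
^-∸-step k (suc n) zero    = NP.≤-refl
^-∸-step k zero    (suc D) = s≤s z≤n
^-∸-step k (suc n) (suc D) = ^-∸-step k n D

-- Σ_{i ≤ D} C(n,i) K^(n−D) ≤ Σ_i C(n,i) K^(n−i) = (K+1)^n
binSum-weighted : ∀ k n D → binSum n D * suc k ^ (n ∸ D) ≤ suc (suc k) ^ n
binSum-weighted k zero    zero    = NP.≤-refl
binSum-weighted k zero    (suc D) = NP.≤-reflexive (cong (_* 1) (binSum-zero (suc D)))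
binSum-weighted k (suc n) zero    = NP.≤-trans (NP.≤-reflexive (NP.*-identityˡ (suc k ^ suc n)))
                                               (NP.^-monoˡ-≤ (suc n) (NP.n≤1+n (suc k)))
binSum-weighted k (suc n) (suc D) = begin
    binSum (suc n) (suc D) * K ^ (n ∸ D)
  ≡⟨ cong (_* K ^ (n ∸ D)) (binSum-pascal n D) ⟩
    (binSum n (suc D) + binSum n D) * K ^ (n ∸ D)
  ≡⟨ NP.*-distribʳ-+ (K ^ (n ∸ D)) (binSum n (suc D)) (binSum n D) ⟩
    binSum n (suc D) * K ^ (n ∸ D) + binSum n D * K ^ (n ∸ D)
  ≤⟨ NP.+-mono-≤ (NP.*-monoʳ-≤ (binSum n (suc D)) (^-∸-step k n D)) (binSum-weighted k n D) ⟩
    binSum n (suc D) * (K * K ^ (n ∸ suc D)) + suc K ^ n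
  ≡⟨ cong (_+ suc K ^ n) (regroup (binSum n (suc D)) K (K ^ (n ∸ suc D))) ⟩
    K * (binSum n (suc D) * K ^ (n ∸ suc D)) + suc K ^ n
  ≤⟨ NP.+-monoˡ-≤ (suc K ^ n) (NP.*-monoʳ-≤ K (binSum-weighted k n (suc D))) ⟩
    K * suc K ^ n + suc K ^ n
  ≡⟨ NP.+-comm (K * suc K ^ n) (suc K ^ n) ⟩
    suc K ^ suc n
  ∎
  where
  open NP.≤-Reasoning
  K = suc k
  regroup : ∀ a K b → a * (K * b) ≡ K * (a * b)
  regroup = solve-∀

binSum^suc-K-bound : ∀ k n D → D * suc (suc k) ≤ n →
                     binSum n D ^ suc (suc k) * suc k ^ (n * suc k) ≤ suc (suc k) ^ (n * suc (suc k))
binSum^suc-K-bound k n D D*K+1≤n = begin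
    binSum n D ^ suc K * K ^ (n * K)                ≤⟨ NP.*-monoʳ-≤ (binSum n D ^ suc K) (NP.^-monoʳ-≤ K exponent) ⟩
    binSum n D ^ suc K * K ^ ((n ∸ D) * suc K)      ≡⟨ cong (binSum n D ^ suc K *_) (NP.^-*-assoc K (n ∸ D) (suc K)) ⟨
    binSum n D ^ suc K * (K ^ (n ∸ D)) ^ suc K      ≡⟨ ^-distrib-* (binSum n D) (K ^ (n ∸ D)) (suc K) ⟨
    (binSum n D * K ^ (n ∸ D)) ^ suc K              ≤⟨ NP.^-monoˡ-≤ (suc K) (binSum-weighted k n D) ⟩
    (suc K ^ n) ^ suc K                             ≡⟨ NP.^-*-assoc (suc K) n (suc K) ⟩
    suc K ^ (n * suc K)                             ∎
  where
  open NP.≤-Reasoning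
  K = suc k
  D≤n = NP.≤-trans (NP.m≤m*n D (suc K)) D*K+1≤n
  exponent : n * K ≤ (n ∸ D) * suc K
  exponent = NP.+-cancelʳ-≤ n (n * K) ((n ∸ D) * suc K) (begin
    n * K + n                     ≡⟨ NP.+-comm (n * K) n ⟩
    n + n * K                     ≡⟨ NP.*-suc n K ⟨
    n * suc K                     ≡⟨ cong (_* suc K) (NP.m∸n+n≡m D≤n) ⟨
    ((n ∸ D) + D) * suc K         ≡⟨ NP.*-distribʳ-+ (suc K) (n ∸ D) D ⟩
    (n ∸ D) * suc K + D * suc K   ≤⟨ NP.+-monoʳ-≤ ((n ∸ D) * suc K) D*K+1≤n ⟩
    (n ∸ D) * suc K + n           ∎)

binSum-entropy-bound : ∀ {n D K} → 0 < K → D * suc K ≤ n → ∀ {p q} → AboveE p q →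
               binSum n D ^ suc K * q ^ n ≤ (suc K * p) ^ n
binSum-entropy-bound {n} {D} {suc k} _ D*K+1≤n {p} {q} aboveE =
  NP.*-cancelʳ-≤ (binSum n D ^ suc K * q ^ n) ((suc K * p) ^ n) (K ^ (n * K)) {{NP.m^n≢0 K (n * K)}} (begin
    binSum n D ^ suc K * q ^ n * K ^ (n * K)   ≡⟨ swap₂₃ (binSum n D ^ suc K) (q ^ n) (K ^ (n * K)) ⟩
    binSum n D ^ suc K * K ^ (n * K) * q ^ n   ≤⟨ NP.*-monoˡ-≤ (q ^ n) (binSum^suc-K-bound k n D D*K+1≤n) ⟩
    suc K ^ (n * suc K) * q ^ n                ≡⟨ cong (_* q ^ n) (trans (cong (suc K ^_) (NP.*-suc n K))
                                                                         (NP.^-distribˡ-+-* (suc K) n (n * K))) ⟩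
    suc K ^ n * suc K ^ (n * K) * q ^ n        ≡⟨ cong (λ t → suc K ^ n * t * q ^ n) (power-of-power (suc K)) ⟩
    suc K ^ n * (suc K ^ K) ^ n * q ^ n        ≡⟨ NP.*-assoc (suc K ^ n) ((suc K ^ K) ^ n) (q ^ n) ⟩
    suc K ^ n * ((suc K ^ K) ^ n * q ^ n)      ≡⟨ cong (suc K ^ n *_) (^-distrib-* (suc K ^ K) q n) ⟨
    suc K ^ n * (suc K ^ K * q) ^ n            ≤⟨ NP.*-monoʳ-≤ (suc K ^ n) (NP.^-monoˡ-≤ n (compound-interest≤aboveE k aboveE)) ⟩
    suc K ^ n * (K ^ K * p) ^ n                ≡⟨ cong (suc K ^ n *_) (^-distrib-* (K ^ K) p n) ⟩
    suc K ^ n * ((K ^ K) ^ n * p ^ n)          ≡⟨ regroup (suc K ^ n) ((K ^ K) ^ n) (p ^ n) ⟩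
    suc K ^ n * p ^ n * (K ^ K) ^ n            ≡⟨ cong₂ _*_ (^-distrib-* (suc K) p n) (power-of-power K) ⟨
    (suc K * p) ^ n * K ^ (n * K)              ∎)
  where
  open NP.≤-Reasoning
  K = suc k
  power-of-power : ∀ a → a ^ (n * K) ≡ (a ^ K) ^ n
  power-of-power a = trans (cong (a ^_) (NP.*-comm n K)) (sym (NP.^-*-assoc a K n))
  swap₂₃ : ∀ a b c → a * b * c ≡ a * c * b
  swap₂₃ = solve-∀
  regroup : ∀ a b c → a * (b * c) ≡ a * c * b
  regroup = solve-∀

corollary2p2 : ∀ {m n} (A : Matrix m n) (K : ℕ) → 0 < K → PairCondition A K →
    ∀ d → Dim (RowSpace A) d → ∀ D → IsDiameter (RowSpace A) D →
    (2 ^ d ≤ binSum n D) ×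
    (∀ p q → 1 ≤ q → AboveE p q →
      binSum n D ^ suc K * q ^ n ≤ (suc K * p) ^ n)
corollary2p2 {n = n} A K 0<K pairs d dim D diameter =
  dim≤binSum (RowSpace A) dim (proj₁ diameter) ,
  λ p q _ aboveE → binSum-entropy-bound {n} {D} 0<K (diameter*suc-K≤n A K pairs D diameter) {p} {q} aboveE
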